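{- Let $A$ be an arena, $\sigma : A$ a causal strategy, and $m, n \in |\sigma|$. If $m <_\sigma n$ immediately (with no event strictly in between), then $\mathrm{pol}(m) \neq \mathrm{pol}(n)$.
   Context: An arena is an event structure with polarities and symmetry which is alternating (immediately related events have different polarities), forestial and race-free. A causal strategy $\sigma : A$ is an event structure with symmetry with a display map $\partial_\sigma : |\sigma|\to|A|$ (locally injective map of event structures with symmetry), polarities imported from $A$, which is courteous: if $s_1<_\sigma s_2$ immediately and $\mathrm{pol}(s_1)=+$ or $\mathrm{pol}(s_2)=-$, then $\partial_\sigma(s_1)<_A\partial_\sigma(s_2)$ immediately; and receptive. -}

module Defs where

open import Data.List using (List; []; _∷_)
open import Data.List.Membership.Propositional using (_∈_)
open import Data.List.Relation.Unary.All using (All)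
open import Data.Product using (Σ; Σ-syntax; _×_; _,_)
open import Data.Sum using (_⊎_)
open import Data.Empty using (⊥)
open import Relation.Nullary using (¬_)
open import Relation.Binary.PropositionalEquality using (_≡_)

data Pol : Set where
  plus minus : Pol

Subset : Set → Set₁
Subset E = E → Set

_⊆_ : {E : Set} → Subset E → Subset E → Set
x ⊆ y = ∀ e → x e → y e

_⇔ₛ_ : {E : Set} → Subset E → Subset E → Set
x ⇔ₛ y = x ⊆ y × y ⊆ x

Rel : Set → Set₁
Rel E = E → E → Set

_⊆₂_ : {E : Set} → Rel E → Rel E → Set
θ ⊆₂ φ = ∀ a b → θ a b → φ a b

dom : {E : Set} → Rel E → Subset E
dom θ a = Σ[ b ∈ _ ] θ a b

cod : {E : Set} → Rel E → Subset E
cod θ b = Σ[ a ∈ _ ] θ a b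

Finite : {E : Set} → Subset E → Set
Finite {E} x = Σ[ L ∈ List E ] (∀ e → (x e → e ∈ L) × (e ∈ L → x e))

IsBijRel : {E : Set} → Rel E → Set
IsBijRel θ = (∀ a b b' → θ a b → θ a b' → b ≡ b')
           × (∀ a a' b → θ a b → θ a' b → a ≡ a')

record EventStructure : Set₁ where
  field
    E        : Set
    _≤_      : E → E → Set
    ≤-refl   : ∀ e → e ≤ e
    ≤-trans  : ∀ {a b c} → a ≤ b → b ≤ c → a ≤ c
    ≤-antisym : ∀ {a b} → a ≤ b → b ≤ a → a ≡ b
    fin-causes : ∀ e → Finite (λ e' → e' ≤ e)
    Con       : List E → Set
    Con-[]    : Con []
    Con-sing  : ∀ e → Con (e ∷ [])
    Con-sub   : ∀ {X Y} → Con X → (∀ e → e ∈ Y → e ∈ X) → Con Y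
    Con-down  : ∀ {X e e'} → Con X → e ≤ e' → e' ∈ X → Con (e ∷ X)

  _<_ : E → E → Set
  a < b = a ≤ b × ¬ (a ≡ b)

  _⋖_ : E → E → Set
  a ⋖ b = a < b × (∀ c → a < c → c < b → ⊥)

  IsConfig : Subset E → Set
  IsConfig x = (∀ L → All x L → Con L) × (∀ e e' → e' ≤ e → x e → x e')

  IsFinConfig : Subset E → Set
  IsFinConfig x = IsConfig x × Finite x

-- Event structures with symmetry (isomorphism families on finite
-- configurations; bijections represented by their graphs)

record ESS : Set₁ where
  field
    ES : EventStructure
  open EventStructure ES public
  field
    S        : Rel E → Set
    S-bij    : ∀ {θ} → S θ → IsBijRel θ × IsFinConfig (dom θ) × IsFinConfig (cod θ)
    S-resp   : ∀ {θ θ'} → S θ → θ ⊆₂ θ' → θ' ⊆₂ θ → S θ'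
    S-id     : ∀ {x} → IsFinConfig x → S (λ a b → x a × a ≡ b)
    S-inv    : ∀ {θ} → S θ → S (λ a b → θ b a)
    S-comp   : ∀ {θ φ} → S θ → S φ → cod θ ⇔ₛ dom φ →
               S (λ a c → Σ[ b ∈ E ] (θ a b × φ b c))
    S-restr  : ∀ {θ z} → S θ → IsFinConfig z → z ⊆ dom θ →
               S (λ a b → z a × θ a b)
    S-ext    : ∀ {θ x'} → S θ → IsFinConfig x' → dom θ ⊆ x' →
               Σ[ θ' ∈ Rel E ] (S θ' × θ ⊆₂ θ' × dom θ' ⇔ₛ x')

image : {E E' : Set} → (E → E') → Subset E → Subset E'
image f x a = Σ[ e ∈ _ ] (x e × f e ≡ a)

record IsESSMap (P Q : ESS) (f : ESS.E P → ESS.E Q) : Set₁ where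
  private
    module P = ESS P
    module Q = ESS Q
  field
    pres-config : ∀ {x} → P.IsFinConfig x → Q.IsFinConfig (image f x)
    loc-inj     : ∀ {x} → P.IsFinConfig x → ∀ a b → x a → x b → f a ≡ f b → a ≡ b
    pres-sym    : ∀ {θ} → P.S θ →
                  Q.S (λ a' b' → Σ[ a ∈ P.E ] Σ[ b ∈ P.E ] (θ a b × f a ≡ a' × f b ≡ b'))

_∪｛_｝ : {E : Set} → Subset E → E → Subset E
(x ∪｛ a ｝) e = x e ⊎ e ≡ a

record Arena : Set₁ where
  field
    ess : ESS
  open ESS ess public
  field
    pol       : E → Pol
    pol-sym   : ∀ {θ a b} → S θ → θ a b → pol a ≡ pol b
    alternating : ∀ {a b} → a ⋖ b → ¬ (pol a ≡ pol b)
    forestial : ∀ {a b c} → a ≤ c → b ≤ c → a ≤ b ⊎ b ≤ a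
    race-free : ∀ {x a b} → IsFinConfig x → ¬ x a → ¬ x b →
                IsFinConfig (x ∪｛ a ｝) → IsFinConfig (x ∪｛ b ｝) →
                ¬ (pol a ≡ pol b) →
                IsFinConfig ((x ∪｛ a ｝) ∪｛ b ｝)

record Strategy (A : Arena) : Set₁ where
  private module A = Arena A
  field
    ess : ESS
  open ESS ess public
  field
    ∂      : E → A.E
    ∂-map  : IsESSMap ess A.ess ∂

  pol : E → Pol
  pol s = A.pol (∂ s)

  field
    courteous : ∀ {s₁ s₂} → s₁ ⋖ s₂ → (pol s₁ ≡ plus ⊎ pol s₂ ≡ minus) →
                ∂ s₁ A.⋖ ∂ s₂
    receptive : ∀ {x a} → IsFinConfig x → ¬ image ∂ x a →
                A.IsFinConfig (image ∂ x ∪｛ a ｝) → A.pol a ≡ minus →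
                Σ[ s ∈ E ] ((¬ x s × IsFinConfig (x ∪｛ s ｝) × ∂ s ≡ a)
                  × (∀ s' → ¬ x s' → IsFinConfig (x ∪｛ s' ｝) → ∂ s' ≡ a → s' ≡ s))

module Submission where

open import Defs
open import Data.Sum using (_⊎_; inj₁; inj₂)
open import Relation.Nullary using (¬_)
open import Relation.Binary.PropositionalEquality using (_≡_; refl)

-- A strategy's immediate causal link between equal polarities is preserved by
-- the display map, since courtesy covers both the (+,+) and the (-,-) case;
-- alternation of the arena then rules such a link out.

plus-source-or-minus-target : (p q : Pol) → p ≡ q → p ≡ plus ⊎ q ≡ minus
plus-source-or-minus-target plus  _ _    = inj₁ refl
plus-source-or-minus-target minus _ refl = inj₂ refl

module _ {A : Arena} (σ : Strategy A) where
  open Strategy σ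
  private module A = Arena A

  ∂-⋖-if-pol≡ : ∀ {m n} → m ⋖ n → pol m ≡ pol n → ∂ m A.⋖ ∂ n
  ∂-⋖-if-pol≡ {m} {n} m⋖n eq =
    courteous m⋖n (plus-source-or-minus-target (pol m) (pol n) eq)

lemmaA3 : (A : Arena) (σ : Strategy A) (m n : Strategy.E σ) →
    Strategy._⋖_ σ m n → ¬ (Strategy.pol σ m ≡ Strategy.pol σ n)
lemmaA3 A σ m n m⋖n eq = Arena.alternating A (∂-⋖-if-pol≡ σ m⋖n eq) eq
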